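{- Let $C$ be a finite set, $p\ge1$, and let $c:C^p\to C$ be cyclic, i.e. $c(x_1,\dots,x_p)=c(x_2,\dots,x_p,x_1)$ for all $x_i\in C$. Define $t:C^{p^2}\to C$ by $$t(x_{11},x_{21},\dots,x_{p1},\ x_{12},\dots,x_{p2},\ \dots,\ x_{1p},\dots,x_{pp})=c\big(c(x_{11},\dots,x_{p1}),c(x_{12},\dots,x_{p2}),\dots,c(x_{1p},\dots,x_{pp})\big).$$ Then $t$ is a $b$-bounded doubly cyclic function for $b=|C|^{|C|^2}$.
   Context: A function $t:A^{p^2}\to B$, with arguments written as $p$ consecutive blocks $\mathbf x_1,\dots,\mathbf x_p$ of length $p$, is doubly cyclic if (a) $t(\mathbf x_1,\dots,\mathbf x_p)=t(\mathbf y_1,\dots,\mathbf y_p)$ whenever each $\mathbf y_i$ is a cyclic shift of $\mathbf x_i$ (independently for each $i$), and (b) $t(\mathbf x_1,\dots,\mathbf x_p)=t(\mathbf x_2,\dots,\mathbf x_p,\mathbf x_1)$, for all values. An $x/y$-tuple is a $p$-tuple each of whose entries is one of two variable symbols $x,y$. A doubly cyclic $t$ is $b$-bounded if there is an equivalence relation $\sim$ on the set of all $p$-ary $x/y$-tuples with at most $b$ classes such that $t(\mathbf x_1,\dots,\mathbf x_p)=t(\mathbf y_1,\dots,\mathbf y_p)$ holds identically (for all values of $x,y$ in $A$) whenever $\mathbf x_i,\mathbf y_i$ are $x/y$-tuples with $\mathbf x_i\sim\mathbf y_i$ for every $i\in[p]$. -}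

module Defs where

open import Data.Nat using (ℕ; zero; suc; _≤_)
open import Data.Vec using (Vec; []; _∷_; _∷ʳ_; map)
open import Data.Vec.Relation.Binary.Pointwise.Inductive using (Pointwise)
open import Data.List using (List; length)
open import Data.List.Relation.Unary.Any using (Any)
open import Data.Product using (Σ; ∃; _×_)
open import Relation.Binary.PropositionalEquality using (_≡_)
open import Relation.Binary.Structures using (IsEquivalence)

rot : ∀ {A : Set} {p : ℕ} → Vec A p → Vec A p
rot []       = []
rot (x ∷ xs) = xs ∷ʳ x

rotN : ∀ {A : Set} {p : ℕ} → ℕ → Vec A p → Vec A p
rotN zero    v = v
rotN (suc k) v = rot (rotN k v)

IsCyclicShift : ∀ {A : Set} {p : ℕ} → Vec A p → Vec A p → Set
IsCyclicShift x y = ∃ λ k → y ≡ rotN k x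

Cyclic : ∀ {A B : Set} (p : ℕ) → (Vec A p → B) → Set
Cyclic {A} p c = ∀ (x : Vec A p) → c x ≡ c (rot x)

-- arguments of A^{p²} are represented as p consecutive blocks of length p
DoublyCyclic : ∀ {A B : Set} (p : ℕ) → (Vec (Vec A p) p → B) → Set
DoublyCyclic {A} p t =
  (∀ (xs ys : Vec (Vec A p) p) → Pointwise IsCyclicShift xs ys → t xs ≡ t ys)
  × (∀ (xs : Vec (Vec A p) p) → t xs ≡ t (rot xs))

data XY : Set where
  𝕩 𝕪 : XY

evalXY : ∀ {A : Set} → A → A → XY → A
evalXY a b 𝕩 = a
evalXY a b 𝕪 = b

evalBlocks : ∀ {A : Set} {p : ℕ} → A → A → Vec (Vec XY p) p → Vec (Vec A p) p
evalBlocks a b us = map (map (evalXY a b)) us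

AtMostClasses : ∀ {X : Set} → (X → X → Set) → ℕ → Set
AtMostClasses {X} _~_ b =
  Σ (List X) λ reps → (length reps ≤ b) × (∀ (u : X) → Any (u ~_) reps)

Bounded : ∀ {A B : Set} (p : ℕ) → ℕ → (Vec (Vec A p) p → B) → Set₁
Bounded {A} p b t =
  Σ (Vec XY p → Vec XY p → Set) λ _~_ →
    IsEquivalence _~_ × AtMostClasses _~_ b ×
    (∀ (us vs : Vec (Vec XY p) p) → Pointwise _~_ us vs →
       ∀ (x y : A) → t (evalBlocks x y us) ≡ t (evalBlocks x y vs))

-- t(x₁,…,xₚ) = c(c(x₁),…,c(xₚ)) where xⱼ is the j-th block (x₁ⱼ,…,xₚⱼ)
twoLevel : ∀ {C : Set} {p : ℕ} → (Vec C p → C) → Vec (Vec C p) p → C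
twoLevel c xs = c (map c xs)

-- Since c is cyclic, c (c x₁, …, c xₚ) is unchanged by rotating any inner block and
-- by rotating the blocks, so t is doubly cyclic. For boundedness, call two x/y-tuples
-- u, v equivalent when they induce the same binary operation (x, y) ↦ c (u[x, y]) on C.
-- Each block of t then contributes only its operation, and there are at most
-- |C|^(|C|²) binary operations on C, hence at most that many classes.
module Submission where

open import Defs
open import Data.Nat using (ℕ; zero; suc; _≤_; z≤n; _^_)
open import Data.Fin using (Fin)
open import Data.Vec using (Vec; []; _∷_; map; lookup)
open import Data.Product using (_×_)
open import Function.Bundles using (_↔_)

open import Data.Nat.Properties using (≤-reflexive)
open import Data.Fin as Fin using (funToFin; finToFun; _≟_)
open import Data.Fin.Properties using (finToFun-funToFin)
open import Data.Vec.Properties using (map-∷ʳ; map-∘)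
open import Data.Vec.Relation.Binary.Pointwise.Inductive using (Pointwise; map⁺; Pointwise-≡⇒≡)
open import Data.List as List using (List; _++_; tabulate)
open import Data.List.Properties using (length-tabulate)
open import Data.List.Relation.Unary.Any as Any using (any?; satisfied)
open import Data.List.Membership.Propositional using (_∈_)
open import Data.List.Membership.Propositional.Properties using (∈-map⁺; ∈-++⁺ˡ; ∈-++⁺ʳ; ∈-tabulate⁺)
open import Data.Product using (_,_; proj₁; proj₂)
open import Data.Empty using (⊥-elim)
open import Function using (_∘′_; _on_; case_of_)
open import Function.Bundles using (Inverse)
open import Relation.Binary.PropositionalEquality
open import Relation.Nullary using (yes; no)
import Relation.Binary.Construct.On as On

cyclic-rotN : ∀ {A B : Set} {p} {c : Vec A p → B} → Cyclic p c → ∀ k x → c (rotN k x) ≡ c x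
cyclic-rotN c-cyc zero    x = refl
cyclic-rotN c-cyc (suc k) x = trans (sym (c-cyc (rotN k x))) (cyclic-rotN c-cyc k x)

map-rot : ∀ {A B : Set} {n} (f : A → B) (xs : Vec A n) → map f (rot xs) ≡ rot (map f xs)
map-rot f []       = refl
map-rot f (x ∷ xs) = map-∷ʳ f x xs

map-cong-Pointwise : ∀ {A B : Set} {n} {R : A → A → Set} {f : A → B} →
  (∀ {x y} → R x y → f x ≡ f y) → {xs ys : Vec A n} → Pointwise R xs ys → map f xs ≡ map f ys
map-cong-Pointwise R⇒≡ = Pointwise-≡⇒≡ ∘′ map⁺ R⇒≡

composite-doublyCyclic : ∀ {A B D : Set} {p} {g : Vec B p → D} {c : Vec A p → B} →
  Cyclic p g → Cyclic p c → DoublyCyclic p (λ xs → g (map c xs))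
composite-doublyCyclic {g = g} {c} g-cyc c-cyc = shift-blocks , rotate-blocks
  where
  shift-blocks : ∀ xs ys → Pointwise IsCyclicShift xs ys → g (map c xs) ≡ g (map c ys)
  shift-blocks xs ys shifts =
    cong g (map-cong-Pointwise (λ { (k , refl) → sym (cyclic-rotN c-cyc k _) }) shifts)

  rotate-blocks : ∀ xs → g (map c xs) ≡ g (map c (rot xs))
  rotate-blocks xs = trans (g-cyc (map c xs)) (cong g (sym (map-rot c xs)))

module _ {C : Set} {n : ℕ} (C↔Fin : C ↔ Fin n) where
  open Inverse C↔Fin

  -- A binary operation is tabulated on Fin (n ^ 2), which codes the pairs Fin 2 → Fin n.
  pairToFin : C → C → Fin (n ^ 2)
  pairToFin x y = funToFin (lookup (to x ∷ to y ∷ []))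

  binOpTable : (C → C → C) → Fin (n ^ 2) → Fin n
  binOpTable _∙_ i = to (from (pair Fin.zero) ∙ from (pair (Fin.suc Fin.zero)))
    where
    pair : Fin 2 → Fin n
    pair = finToFun i

  binOpToFin : (C → C → C) → Fin (n ^ (n ^ 2))
  binOpToFin _∙_ = funToFin (binOpTable _∙_)

  finToBinOp : Fin (n ^ (n ^ 2)) → C → C → C
  finToBinOp k x y = from (finToFun k (pairToFin x y))

  finToBinOp-binOpToFin : ∀ _∙_ x y → finToBinOp (binOpToFin _∙_) x y ≡ x ∙ y
  finToBinOp-binOpToFin _∙_ x y = begin
    from (finToFun (funToFin (binOpTable _∙_)) (pairToFin x y))
      ≡⟨ cong from (finToFun-funToFin (binOpTable _∙_) (pairToFin x y)) ⟩
    from (binOpTable _∙_ (pairToFin x y))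
      ≡⟨ strictlyInverseʳ _ ⟩
    from (finToFun {n} {2} (pairToFin x y) Fin.zero) ∙ from (finToFun {n} {2} (pairToFin x y) (Fin.suc Fin.zero))
      ≡⟨ cong₂ (λ a b → from a ∙ from b) (finToFun-funToFin xy Fin.zero) (finToFun-funToFin xy (Fin.suc Fin.zero)) ⟩
    from (to x) ∙ from (to y)
      ≡⟨ cong₂ _∙_ (strictlyInverseʳ x) (strictlyInverseʳ y) ⟩
    x ∙ y ∎
    where
    open ≡-Reasoning
    xy : Fin 2 → Fin n
    xy = lookup (to x ∷ to y ∷ [])

  binOpToFin-injective : ∀ {f g} → binOpToFin f ≡ binOpToFin g → ∀ x y → f x y ≡ g x y
  binOpToFin-injective {f} {g} f≡g x y = begin
    f x y                           ≡⟨ sym (finToBinOp-binOpToFin f x y) ⟩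
    finToBinOp (binOpToFin f) x y   ≡⟨ cong (λ k → finToBinOp k x y) f≡g ⟩
    finToBinOp (binOpToFin g) x y   ≡⟨ finToBinOp-binOpToFin g x y ⟩
    g x y                           ∎
    where open ≡-Reasoning

kernel-atMostClasses : ∀ {X : Set} {m} (f : X → Fin m) (xs : List X) → (∀ x → x ∈ xs) →
  AtMostClasses (_≡_ on f) m
kernel-atMostClasses f List.[] complete = List.[] , z≤n , λ u → case complete u of λ ()
kernel-atMostClasses {X} {m} f xs@(x₀ List.∷ _) complete =
  tabulate pick , ≤-reflexive (length-tabulate pick) , covers
  where
  pick : Fin m → X
  pick k with any? (λ x → f x ≟ k) xs
  ... | yes hit = proj₁ (satisfied hit)
  ... | no _    = x₀

  f-pick : ∀ u → f (pick (f u)) ≡ f u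
  f-pick u with any? (λ x → f x ≟ f u) xs
  ... | yes hit  = proj₂ (satisfied hit)
  ... | no ¬hit  = ⊥-elim (¬hit (Any.map (λ { refl → refl }) (complete u)))

  covers : ∀ u → Any.Any (λ r → f u ≡ f r) (tabulate pick)
  covers u = Any.map (λ { refl → sym (f-pick u) }) (∈-tabulate⁺ {f = pick} (f u))

allXY : ∀ p → List (Vec XY p)
allXY zero    = List.[ [] ]
allXY (suc p) = List.map (𝕩 ∷_) (allXY p) ++ List.map (𝕪 ∷_) (allXY p)

∈-allXY : ∀ {p} (u : Vec XY p) → u ∈ allXY p
∈-allXY []                = Any.here refl
∈-allXY {suc p} (𝕩 ∷ u) = ∈-++⁺ˡ (∈-map⁺ (𝕩 ∷_) (∈-allXY u))
∈-allXY {suc p} (𝕪 ∷ u) = ∈-++⁺ʳ (List.map (𝕩 ∷_) (allXY p)) (∈-map⁺ (𝕪 ∷_) (∈-allXY u))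

blockOp : ∀ {C : Set} {p} → (Vec C p → C) → Vec XY p → C → C → C
blockOp c u x y = c (map (evalXY x y) u)

composite-bounded : ∀ {B C : Set} {n p} → C ↔ Fin n → (g : Vec C p → B) (c : Vec C p → C) →
  Bounded p (n ^ (n ^ 2)) (λ xs → g (map c xs))
composite-bounded {n = n} {p} C↔Fin g c =
  (_≡_ on code) , On.isEquivalence code isEquivalence , kernel-atMostClasses code (allXY p) ∈-allXY , respects
  where
  code : Vec XY p → Fin (n ^ (n ^ 2))
  code u = binOpToFin C↔Fin (blockOp c u)

  respects : ∀ us vs → Pointwise (_≡_ on code) us vs → ∀ x y →
    g (map c (evalBlocks x y us)) ≡ g (map c (evalBlocks x y vs))
  respects us vs us~vs x y = cong g (begin
    map c (map (map (evalXY x y)) us)   ≡⟨ sym (map-∘ c _ us) ⟩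
    map (λ u → blockOp c u x y) us       ≡⟨ map-cong-Pointwise same-op us~vs ⟩
    map (λ u → blockOp c u x y) vs       ≡⟨ map-∘ c _ vs ⟩
    map c (map (map (evalXY x y)) vs)   ∎)
    where
    open ≡-Reasoning
    same-op : ∀ {u v} → code u ≡ code v → blockOp c u x y ≡ blockOp c v x y
    same-op {u} {v} u~v = binOpToFin-injective C↔Fin {blockOp c u} {blockOp c v} u~v x y

lemma18 : (C : Set) (n : ℕ) → C ↔ Fin n → (p : ℕ) → 1 ≤ p →
    (c : Vec C p → C) → Cyclic p c →
    DoublyCyclic p (twoLevel c) × Bounded p (n ^ (n ^ 2)) (twoLevel c)
lemma18 C n C↔Fin p _ c c-cyc = composite-doublyCyclic c-cyc c-cyc , composite-bounded C↔Fin c c
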